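{- Let $a$ and $x$ be real numbers and let $\{a_n\}_{n\ge0}$, $\{b_n\}_{n\ge 0}$ be sequences of (real or complex) numbers. Then $$b_n=\sum_{k=0}^n\binom nk\Big((1-a)(-x)^k+\frac a2\big((1-x)^k+(-1-x)^k\big)\Big)a_{n-k}\ \text{ for all } n\ge 0$$ if and only if $$a_n=\sum_{k=0}^n\binom nk E_{k,a}(x)b_{n-k}\ \text{ for all } n\ge 0.$$
   Context: For a real number $a$, the sequence $\{E_{n,a}\}$ is defined by $E_{0,a}=1$ and $E_{n,a}=-a\sum_{k=1}^{\lfloor n/2\rfloor}\binom{n}{2k}E_{n-2k,a}$ for $n\ge 1$, and the polynomials $E_{n,a}(x)$ are defined by $E_{n,a}(x)=\sum_{k=0}^n\binom nk E_{k,a}x^{n-k}$ for $n\ge 0$. -}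

module Defs where

open import Level using (Level)
open import Algebra.Bundles using (CommutativeRing)
open import Data.Nat using (ℕ; zero; suc; _∸_; _/_)
import Data.Nat as ℕ
open import Data.Nat.Combinatorics using (_C_)

module _ {c ℓ : Level} (R : CommutativeRing c ℓ) where
  open CommutativeRing R

  nat : ℕ → Carrier
  nat zero = 0#
  nat (suc m) = 1# + nat m

  pow : Carrier → ℕ → Carrier
  pow y zero = 1#
  pow y (suc m) = y * pow y m

  sumBelow : ℕ → (ℕ → Carrier) → Carrier
  sumBelow zero f = 0#
  sumBelow (suc m) f = sumBelow m f + f m

  sumTo : ℕ → (ℕ → Carrier) → Carrier
  sumTo n f = sumBelow (suc n) f

  -- Auxiliary fuel-indexed version of E_{n,a}; the fuel argument only
  -- ensures termination (it is always large enough when used via Eseq).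
  Efuel : Carrier → ℕ → ℕ → Carrier
  Efuel a zero n = 1#
  Efuel a (suc f) zero = 1#
  Efuel a (suc f) (suc m) =
    - (a * sumBelow (suc m / 2)
             (λ j → nat (suc m C (2 ℕ.* suc j)) * Efuel a f (suc m ∸ 2 ℕ.* suc j)))

  -- E_{0,a} = 1,  E_{n,a} = -a Σ_{k=1}^{⌊n/2⌋} C(n,2k) E_{n-2k,a}
  Eseq : Carrier → ℕ → Carrier
  Eseq a n = Efuel a n n

  Epoly : Carrier → ℕ → Carrier → Carrier
  Epoly a n x = sumTo n (λ k → nat (n C k) * (Eseq a k * pow x (n ∸ k)))

-- Write (f ⋆ g) n = Σ_{k ≤ n} C(n,k) f k g (n-k) for the binomial
-- convolution of two sequences; it is the coefficient-wise form of the
-- product of exponential generating functions.  Over any commutative ring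
-- ⋆ is commutative and associative with unit δ = (1,0,0,…), and the
-- binomial theorem reads  u^• ⋆ v^• = (u+v)^•.  Hence, as soon as
-- F ⋆ G = δ, the relations  b = F ⋆ a  and  a = G ⋆ b  are equivalent.
--
-- For the theorem, F k = (1-a)(-x)^k + (a/2)((1-x)^k + (-1-x)^k) and
-- G k = E_{k,a}(x) = (E ⋆ x^•) k.  By associativity and the binomial
-- theorem F ⋆ G = (F ⋆ x^•) ⋆ E = H ⋆ E with
-- H m = (1-a) δ m + a ε m, where ε is the indicator of the even numbers
-- (built from 1/2 as ε m = (1^m + (-1)^m)/2).  Finally H ⋆ E = δ is exactly
-- the defining recurrence of E_{n,a}, once the sum over even k is
-- re-indexed as a sum over k = 2j.

module Submission where

open import Defs
open import Level using (Level)
open import Algebra.Bundles using (CommutativeRing)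
open import Data.Nat using (ℕ; zero; suc; _∸_; _≤_; _<_; z≤n; s≤s; _/_)
import Data.Nat as ℕ
import Data.Nat.Properties as ℕP
open import Data.Nat.DivMod using (m/n≡1+[m∸n]/n)
open import Data.Nat.Combinatorics using (_C_; nCk+nC[k+1]≡[n+1]C[k+1]; k>n⇒nCk≡0)
open import Relation.Binary.PropositionalEquality as P using (_≡_)
open import Data.Product using (_×_; _,_; ∃; proj₁; proj₂)
open import Data.Sum using (_⊎_; inj₁; inj₂)
import Algebra.Properties.CommutativeSemigroup as CommSemigroupProperties
import Algebra.Properties.Ring as RingProperties

module BinomialConvolution {c ℓ : Level} (R : CommutativeRing c ℓ) where
  open CommutativeRing R hiding (zero)
  open import Relation.Binary.Reasoning.Setoid setoid
  private
    module +S = CommSemigroupProperties +-commutativeSemigroup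
    module *S = CommSemigroupProperties *-commutativeSemigroup

  Seq : Set c
  Seq = ℕ → Carrier

  sum-cong< : ∀ m {h h' : Seq} → (∀ k → k < m → h k ≈ h' k) →
              sumBelow R m h ≈ sumBelow R m h'
  sum-cong< zero e = refl
  sum-cong< (suc m) e =
    +-cong (sum-cong< m (λ k k<m → e k (ℕP.m<n⇒m<1+n k<m))) (e m ℕP.≤-refl)

  sum-cong : ∀ m {h h' : Seq} → (∀ k → h k ≈ h' k) → sumBelow R m h ≈ sumBelow R m h'
  sum-cong m e = sum-cong< m (λ k _ → e k)

  sum-+ : ∀ m (h h' : Seq) →
          sumBelow R m (λ k → h k + h' k) ≈ sumBelow R m h + sumBelow R m h'
  sum-+ zero h h' = sym (+-identityˡ 0#)
  sum-+ (suc m) h h' = trans (+-cong (sum-+ m h h') refl) (+S.interchange _ _ _ _)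

  sum-* : ∀ m (d : Carrier) (h : Seq) → sumBelow R m (λ k → d * h k) ≈ d * sumBelow R m h
  sum-* zero d h = sym (zeroʳ d)
  sum-* (suc m) d h = trans (+-cong (sum-* m d h) refl) (sym (distribˡ d _ _))

  sum-0 : ∀ m (h : Seq) → (∀ k → h k ≈ 0#) → sumBelow R m h ≈ 0#
  sum-0 zero h e = refl
  sum-0 (suc m) h e = trans (+-cong (sum-0 m h e) (e m)) (+-identityˡ 0#)

  sum-shift : ∀ m (h : Seq) → sumBelow R (suc m) h ≈ h 0 + sumBelow R m (λ k → h (suc k))
  sum-shift zero h = trans (+-identityˡ _) (sym (+-identityʳ _))
  sum-shift (suc m) h = trans (+-cong (sum-shift m h) refl) (+-assoc _ _ _)

  nat-+ : ∀ m n → nat R (m ℕ.+ n) ≈ nat R m + nat R n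
  nat-+ zero n = sym (+-identityˡ _)
  nat-+ (suc m) n = trans (+-cong refl (nat-+ m n)) (sym (+-assoc _ _ _))

  nat-1 : nat R 1 ≈ 1#
  nat-1 = +-identityʳ 1#

  pow-cong : ∀ {u v} n → u ≈ v → pow R u n ≈ pow R v n
  pow-cong zero e = refl
  pow-cong (suc n) e = *-cong e (pow-cong n e)

  _⋆_ : Seq → Seq → Seq
  (f ⋆ g) n = sumTo R n (λ k → nat R (n C k) * (f k * g (n ∸ k)))
  infixl 7 _⋆_

  -- The shifted sequence k ↦ f (k+1) (derivative of the generating function).
  shift : Seq → Seq
  shift f n = f (suc n)

  -- The unit of ⋆: δ 0 = 1 and δ (k+1) = 0.
  δ : Seq
  δ = pow R 0#

  ⋆-at-0 : ∀ (f g : Seq) → (f ⋆ g) 0 ≈ f 0 * g 0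
  ⋆-at-0 f g = trans (+-identityˡ _) (trans (*-cong nat-1 refl) (*-identityˡ _))

  ⋆-cong : ∀ n {f f' g g' : Seq} → (∀ k → f k ≈ f' k) → (∀ k → g k ≈ g' k) →
           (f ⋆ g) n ≈ (f' ⋆ g') n
  ⋆-cong n ef eg = sum-cong (suc n) (λ k → *-cong refl (*-cong (ef k) (eg (n ∸ k))))

  ⋆-congˡ : ∀ n {f f' : Seq} (g : Seq) → (∀ k → f k ≈ f' k) → (f ⋆ g) n ≈ (f' ⋆ g) n
  ⋆-congˡ n g e = ⋆-cong n {g = g} e (λ _ → refl)

  ⋆-congʳ : ∀ n (f : Seq) {g g' : Seq} → (∀ k → g k ≈ g' k) → (f ⋆ g) n ≈ (f ⋆ g') n
  ⋆-congʳ n f e = ⋆-cong n {f = f} (λ _ → refl) e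

  ⋆-distribˡ : ∀ n (f u v : Seq) → (f ⋆ (λ m → u m + v m)) n ≈ (f ⋆ u) n + (f ⋆ v) n
  ⋆-distribˡ n f u v = trans
    (sum-cong (suc n) (λ k → trans (*-cong refl (distribˡ _ _ _)) (distribˡ _ _ _)))
    (sum-+ (suc n) _ _)

  ⋆-distribʳ : ∀ n (f f' g : Seq) → ((λ m → f m + f' m) ⋆ g) n ≈ (f ⋆ g) n + (f' ⋆ g) n
  ⋆-distribʳ n f f' g = trans
    (sum-cong (suc n) (λ k → trans (*-cong refl (distribʳ _ _ _)) (distribˡ _ _ _)))
    (sum-+ (suc n) _ _)

  ⋆-scaleˡ : ∀ n d (f g : Seq) → ((λ m → d * f m) ⋆ g) n ≈ d * (f ⋆ g) n
  ⋆-scaleˡ n d f g = trans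
    (sum-cong (suc n) (λ k → trans (*-cong refl (*-assoc _ _ _)) (*S.x∙yz≈y∙xz _ _ _)))
    (sum-* (suc n) d _)

  ⋆-scaleʳ : ∀ n d (f g : Seq) → (f ⋆ (λ m → d * g m)) n ≈ d * (f ⋆ g) n
  ⋆-scaleʳ n d f g = trans
    (sum-cong (suc n) (λ k → trans (*-cong refl (*S.x∙yz≈y∙xz _ _ _)) (*S.x∙yz≈y∙xz _ _ _)))
    (sum-* (suc n) d _)

  -- It follows
  -- from Pascal's rule C(n+1,k+1) = C(n,k) + C(n,k+1), and it is the
  -- engine behind all the algebraic laws below (proved by induction on n).
  leibniz : ∀ n (f g : Seq) → (f ⋆ g) (suc n) ≈ (shift f ⋆ g) n + (f ⋆ shift g) n
  leibniz n f g = begin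
      (f ⋆ g) (suc n)
    ≈⟨ sum-shift (suc n) _ ⟩
      first + sumBelow R (suc n) (λ k → nat R (suc n C suc k) * (f (suc k) * g (n ∸ k)))
    ≈⟨ +-cong refl (sum-cong (suc n) pascal) ⟩
      first + sumBelow R (suc n) (λ k → A k + B k)
    ≈⟨ +-cong refl (sum-+ (suc n) A B) ⟩
      first + ((shift f ⋆ g) n + sumBelow R (suc n) B)
    ≈⟨ +S.x∙yz≈y∙xz _ _ _ ⟩
      (shift f ⋆ g) n + (first + sumBelow R (suc n) B)
    ≈⟨ +-cong refl (+-cong refl (trans (+-cong (sum-cong< n reindex) B-last) (+-identityʳ _))) ⟩
      (shift f ⋆ g) n + (first + sumBelow R n (λ k → D (suc k)))
    ≈⟨ +-cong refl (sym (sum-shift n D)) ⟩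
      (shift f ⋆ g) n + (f ⋆ shift g) n
    ∎
    where
    first = nat R (suc n C 0) * (f 0 * g (suc n))
    A B D : Seq
    A k = nat R (n C k) * (f (suc k) * g (n ∸ k))
    B k = nat R (n C suc k) * (f (suc k) * g (n ∸ k))
    D k = nat R (n C k) * (f k * g (suc (n ∸ k)))

    pascal : ∀ k → nat R (suc n C suc k) * (f (suc k) * g (n ∸ k)) ≈ A k + B k
    pascal k = trans
      (*-cong (trans (reflexive (P.cong (nat R) (P.sym (nCk+nC[k+1]≡[n+1]C[k+1] n k))))
                     (nat-+ (n C k) (n C suc k))) refl)
      (distribʳ _ _ _)

    reindex : ∀ k → k < n → B k ≈ D (suc k)
    reindex k k<n =
      *-cong refl (*-cong refl (reflexive (P.cong g (ℕP.+-∸-assoc 1 k<n))))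

    B-last : B n ≈ 0#
    B-last = trans (*-cong (reflexive (P.cong (nat R) (k>n⇒nCk≡0 (ℕP.n<1+n n)))) refl) (zeroˡ _)

  ⋆-comm : ∀ n (f g : Seq) → (f ⋆ g) n ≈ (g ⋆ f) n
  ⋆-comm zero f g = trans (⋆-at-0 f g) (trans (*-comm _ _) (sym (⋆-at-0 g f)))
  ⋆-comm (suc n) f g = begin
      (f ⋆ g) (suc n)
    ≈⟨ leibniz n f g ⟩
      (shift f ⋆ g) n + (f ⋆ shift g) n
    ≈⟨ +-cong (⋆-comm n (shift f) g) (⋆-comm n f (shift g)) ⟩
      (g ⋆ shift f) n + (shift g ⋆ f) n
    ≈⟨ +-comm _ _ ⟩
      (shift g ⋆ f) n + (g ⋆ shift f) n
    ≈⟨ sym (leibniz n g f) ⟩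
      (g ⋆ f) (suc n)
    ∎

  ⋆-assoc : ∀ n (f g h : Seq) → (f ⋆ (g ⋆ h)) n ≈ ((f ⋆ g) ⋆ h) n
  ⋆-assoc zero f g h = begin
      (f ⋆ (g ⋆ h)) 0       ≈⟨ ⋆-at-0 f (g ⋆ h) ⟩
      f 0 * (g ⋆ h) 0       ≈⟨ *-cong refl (⋆-at-0 g h) ⟩
      f 0 * (g 0 * h 0)     ≈⟨ sym (*-assoc _ _ _) ⟩
      (f 0 * g 0) * h 0     ≈⟨ *-cong (sym (⋆-at-0 f g)) refl ⟩
      (f ⋆ g) 0 * h 0       ≈⟨ sym (⋆-at-0 (f ⋆ g) h) ⟩
      ((f ⋆ g) ⋆ h) 0       ∎
  ⋆-assoc (suc n) f g h = begin
      (f ⋆ (g ⋆ h)) (suc n)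
    ≈⟨ leibniz n f (g ⋆ h) ⟩
      (shift f ⋆ (g ⋆ h)) n + (f ⋆ shift (g ⋆ h)) n
    ≈⟨ +-cong refl (trans (⋆-congʳ n f (λ m → leibniz m g h))
                          (⋆-distribˡ n f (shift g ⋆ h) (g ⋆ shift h))) ⟩
      (shift f ⋆ (g ⋆ h)) n + ((f ⋆ (shift g ⋆ h)) n + (f ⋆ (g ⋆ shift h)) n)
    ≈⟨ +-cong (⋆-assoc n (shift f) g h)
              (+-cong (⋆-assoc n f (shift g) h) (⋆-assoc n f g (shift h))) ⟩
      ((shift f ⋆ g) ⋆ h) n + (((f ⋆ shift g) ⋆ h) n + ((f ⋆ g) ⋆ shift h) n)
    ≈⟨ sym (+-assoc _ _ _) ⟩
      (((shift f ⋆ g) ⋆ h) n + ((f ⋆ shift g) ⋆ h) n) + ((f ⋆ g) ⋆ shift h) n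
    ≈⟨ +-cong (sym (trans (⋆-congˡ n h (λ m → leibniz m f g))
                          (⋆-distribʳ n (shift f ⋆ g) (f ⋆ shift g) h))) refl ⟩
      (shift (f ⋆ g) ⋆ h) n + ((f ⋆ g) ⋆ shift h) n
    ≈⟨ sym (leibniz n (f ⋆ g) h) ⟩
      ((f ⋆ g) ⋆ h) (suc n)
    ∎

  ⋆-identityˡ : ∀ n (g : Seq) → (δ ⋆ g) n ≈ g n
  ⋆-identityˡ n g = begin
      (δ ⋆ g) n
    ≈⟨ sum-shift n _ ⟩
      nat R 1 * (1# * g n) + sumBelow R n (λ k → nat R (n C suc k) * (δ (suc k) * g (n ∸ suc k)))
    ≈⟨ +-cong refl (sum-0 n _ (λ k → trans (*-cong refl (trans (*-cong (zeroˡ _) refl) (zeroˡ _)))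
                                           (zeroʳ _))) ⟩
      nat R 1 * (1# * g n) + 0#
    ≈⟨ trans (+-identityʳ _) (trans (*-cong nat-1 (*-identityˡ _)) (*-identityˡ _)) ⟩
      g n
    ∎

  binomial : ∀ n u v → (pow R u ⋆ pow R v) n ≈ pow R (u + v) n
  binomial zero u v = trans (⋆-at-0 (pow R u) (pow R v)) (*-identityˡ 1#)
  binomial (suc n) u v = begin
      (pow R u ⋆ pow R v) (suc n)
    ≈⟨ leibniz n (pow R u) (pow R v) ⟩
      ((λ m → u * pow R u m) ⋆ pow R v) n + (pow R u ⋆ (λ m → v * pow R v m)) n
    ≈⟨ +-cong (⋆-scaleˡ n u (pow R u) (pow R v)) (⋆-scaleʳ n v (pow R u) (pow R v)) ⟩
      u * (pow R u ⋆ pow R v) n + v * (pow R u ⋆ pow R v) n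
    ≈⟨ sym (distribʳ _ _ _) ⟩
      (u + v) * (pow R u ⋆ pow R v) n
    ≈⟨ *-cong refl (binomial n u v) ⟩
      pow R (u + v) (suc n)
    ∎

  ⋆-inversion : ∀ (f g a b : Seq) → (∀ n → (f ⋆ g) n ≈ δ n) →
                (∀ n → b n ≈ (f ⋆ a) n) → ∀ n → a n ≈ (g ⋆ b) n
  ⋆-inversion f g a b fg≈δ b≈fa n = sym (begin
      (g ⋆ b) n          ≈⟨ ⋆-congʳ n g b≈fa ⟩
      (g ⋆ (f ⋆ a)) n    ≈⟨ ⋆-assoc n g f a ⟩
      ((g ⋆ f) ⋆ a) n    ≈⟨ ⋆-congˡ n a (λ m → trans (⋆-comm m g f) (fg≈δ m)) ⟩
      (δ ⋆ a) n          ≈⟨ ⋆-identityˡ n a ⟩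
      a n                ∎)

module EvenSums {c ℓ : Level} (R : CommutativeRing c ℓ)
                (half : CommutativeRing.Carrier R)
                (half+half≈1 : CommutativeRing._≈_ R (CommutativeRing._+_ R half half)
                                                     (CommutativeRing.1# R)) where
  open CommutativeRing R hiding (zero)
  open RingProperties ring using (-1*x≈-x; -‿involutive)
  open BinomialConvolution R using (Seq)

  ε : Seq
  ε m = half * (pow R 1# m + pow R (- 1#) m)

  -- Doubling, defined so that dbl (t+1) reduces to dbl t + 2.
  dbl : ℕ → ℕ
  dbl zero = zero
  dbl (suc t) = suc (suc (dbl t))

  dbl≡2* : ∀ t → dbl t ≡ 2 ℕ.* t
  dbl≡2* zero = P.refl
  dbl≡2* (suc t) = P.trans (P.cong (λ z → suc (suc z)) (dbl≡2* t)) (P.sym (ℕP.*-suc 2 t))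

  parity : ∀ M → ∃ λ t → (M ≡ dbl t) ⊎ (M ≡ suc (dbl t))
  parity zero = zero , inj₁ P.refl
  parity (suc M) with parity M
  ... | t , inj₁ e = t , inj₂ (P.cong suc e)
  ... | t , inj₂ e = suc t , inj₁ (P.cong suc e)

  halve-dbl : ∀ t → (dbl t / 2 ≡ t) × (suc (dbl t) / 2 ≡ t)
  halve-dbl zero = P.refl , P.refl
  halve-dbl (suc t) =
      P.trans (m/n≡1+[m∸n]/n {suc (suc (dbl t))} {2} (s≤s (s≤s z≤n))) (P.cong suc (proj₁ (halve-dbl t)))
    , P.trans (m/n≡1+[m∸n]/n {suc (suc (suc (dbl t)))} {2} (s≤s (s≤s z≤n))) (P.cong suc (proj₂ (halve-dbl t)))

  pow-1 : ∀ n → pow R 1# n ≈ 1#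
  pow-1 zero = refl
  pow-1 (suc n) = trans (*-identityˡ _) (pow-1 n)

  pow-minus1-even : ∀ t → pow R (- 1#) (dbl t) ≈ 1#
  pow-minus1-even zero = refl
  pow-minus1-even (suc t) = trans square (pow-minus1-even t)
    where
    square : - 1# * (- 1# * pow R (- 1#) (dbl t)) ≈ pow R (- 1#) (dbl t)
    square = trans (-1*x≈-x _) (trans (-‿cong (-1*x≈-x _)) (-‿involutive _))

  ε-even : ∀ t → ε (dbl t) ≈ 1#
  ε-even t = trans (*-cong refl (+-cong (pow-1 (dbl t)) (pow-minus1-even t)))
    (trans (distribˡ _ _ _) (trans (+-cong (*-identityʳ _) (*-identityʳ _)) half+half≈1))

  ε-odd : ∀ t → ε (suc (dbl t)) ≈ 0#
  ε-odd t = trans (*-cong refl (trans (+-cong (pow-1 (suc (dbl t))) minus1-odd) (-‿inverseʳ 1#)))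
                  (zeroʳ _)
    where
    minus1-odd : pow R (- 1#) (suc (dbl t)) ≈ - 1#
    minus1-odd = trans (*-cong refl (pow-minus1-even t)) (*-identityʳ _)

  module _ (φ : Seq) where
    private
      ψ χ : Seq
      ψ k = ε (suc k) * φ (suc k)
      χ j = φ (2 ℕ.* suc j)

      -- The claim below for M = 2t and M = 2t+1 simultaneously, by induction on t.
      even-sum-dbl : ∀ t → (sumBelow R (dbl t) ψ ≈ sumBelow R t χ)
                         × (sumBelow R (suc (dbl t)) ψ ≈ sumBelow R t χ)
      even-sum-dbl zero = refl , trans (+-identityˡ _) (trans (*-cong (ε-odd 0) refl) (zeroˡ _))
      even-sum-dbl (suc t) =
        even , trans (+-cong even (trans (*-cong (ε-odd (suc t)) refl) (zeroˡ _))) (+-identityʳ _)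
        where
        even : sumBelow R (suc (suc (dbl t))) ψ ≈ sumBelow R (suc t) χ
        even = +-cong (proj₂ (even-sum-dbl t))
          (trans (*-cong (ε-even (suc t)) refl)
                 (trans (*-identityˡ _) (reflexive (P.cong φ (dbl≡2* (suc t))))))

      sum-bound : ∀ {m n} → m ≡ n → sumBelow R m χ ≈ sumBelow R n χ
      sum-bound e = reflexive (P.cong (λ z → sumBelow R z χ) e)

    even-sum : ∀ M → sumBelow R M (λ k → ε (suc k) * φ (suc k))
                   ≈ sumBelow R (M / 2) (λ j → φ (2 ℕ.* suc j))
    even-sum M with parity M
    ... | t , inj₁ P.refl = trans (proj₁ (even-sum-dbl t)) (sum-bound (P.sym (proj₁ (halve-dbl t))))
    ... | t , inj₂ P.refl = trans (proj₂ (even-sum-dbl t)) (sum-bound (P.sym (proj₂ (halve-dbl t))))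

module EulerNumbers {c ℓ : Level} (R : CommutativeRing c ℓ)
                    (half : CommutativeRing.Carrier R)
                    (half+half≈1 : CommutativeRing._≈_ R (CommutativeRing._+_ R half half)
                                                         (CommutativeRing.1# R))
                    (a x : CommutativeRing.Carrier R) where
  open CommutativeRing R hiding (zero)
  open import Relation.Binary.Reasoning.Setoid setoid
  open BinomialConvolution R
  open EvenSums R half half+half≈1
  private
    module *S = CommSemigroupProperties *-commutativeSemigroup

  E : Seq
  E = Eseq R a

  evenTail : ℕ → Carrier
  evenTail m = sumBelow R (suc m / 2) (λ j → nat R (suc m C 2 ℕ.* suc j) * E (suc m ∸ 2 ℕ.* suc j))

  Efuel-at-0 : ∀ f → Efuel R a f 0 ≈ 1#
  Efuel-at-0 zero = refl
  Efuel-at-0 (suc f) = refl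

  Efuel-irrelevant : ∀ f g k → k ≤ f → k ≤ g → Efuel R a f k ≈ Efuel R a g k
  Efuel-irrelevant f g zero _ _ = trans (Efuel-at-0 f) (sym (Efuel-at-0 g))
  Efuel-irrelevant (suc f) (suc g) (suc k) (s≤s k≤f) (s≤s k≤g) =
    -‿cong (*-cong refl (sum-cong (suc k / 2) (λ j → *-cong refl
      (Efuel-irrelevant f g _ (ℕP.≤-trans (drop j) k≤f) (ℕP.≤-trans (drop j) k≤g)))))
    where
    drop : ∀ j → suc k ∸ 2 ℕ.* suc j ≤ k
    drop j = ℕP.m∸n≤m k (j ℕ.+ suc (j ℕ.+ 0))

  E-recurrence : ∀ m → E (suc m) ≈ - (a * evenTail m)
  E-recurrence m = -‿cong (*-cong refl (sum-cong (suc m / 2) (λ j → *-cong refl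
    (Efuel-irrelevant m _ _ (ℕP.m∸n≤m m (j ℕ.+ suc (j ℕ.+ 0))) ℕP.≤-refl))))

  H : Seq
  H m = (1# - a) * δ m + a * ε m

  H-0 : H 0 ≈ 1#
  H-0 = begin
      (1# - a) * 1# + a * ε 0   ≈⟨ +-cong (*-identityʳ _) (trans (*-cong refl (ε-even 0)) (*-identityʳ a)) ⟩
      (1# - a) + a              ≈⟨ +-assoc _ _ _ ⟩
      1# + (- a + a)            ≈⟨ +-cong refl (-‿inverseˡ a) ⟩
      1# + 0#                   ≈⟨ +-identityʳ 1# ⟩
      1#                        ∎

  H-suc : ∀ k → H (suc k) ≈ a * ε (suc k)
  H-suc k = trans (+-cong (trans (*-cong refl (zeroˡ _)) (zeroʳ _)) refl) (+-identityˡ _)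

  -- H ⋆ E = δ restates the recurrence of E: the terms of H ⋆ E at m+1
  -- with k ≥ 1 only survive for even k, and sum to a · evenTail m.
  H⋆E≈δ : ∀ n → (H ⋆ E) n ≈ δ n
  H⋆E≈δ zero = trans (⋆-at-0 H E) (trans (*-identityʳ _) H-0)
  H⋆E≈δ (suc m) = begin
      (H ⋆ E) (suc m)
    ≈⟨ sum-shift (suc m) _ ⟩
      nat R 1 * (H 0 * E (suc m)) + sumBelow R (suc m) (λ k → nat R (suc m C suc k) * (H (suc k) * E (m ∸ k)))
    ≈⟨ +-cong (trans (*-cong nat-1 (trans (*-cong H-0 refl) (*-identityˡ _))) (*-identityˡ _))
              (sum-cong (suc m) (λ k → rearrange (nat R (suc m C suc k)) (E (m ∸ k)) k)) ⟩
      E (suc m) + sumBelow R (suc m) (λ k → a * (ε (suc k) * φ (suc k)))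
    ≈⟨ +-cong refl (trans (sum-* (suc m) a _) (*-cong refl (even-sum φ (suc m)))) ⟩
      E (suc m) + a * evenTail m
    ≈⟨ +-cong (E-recurrence m) refl ⟩
      - (a * evenTail m) + a * evenTail m
    ≈⟨ -‿inverseˡ _ ⟩
      0#
    ≈⟨ sym (zeroˡ _) ⟩
      δ (suc m)
    ∎
    where
    φ : Seq
    φ j = nat R (suc m C j) * E (suc m ∸ j)

    rearrange : ∀ N e k → N * (H (suc k) * e) ≈ a * (ε (suc k) * (N * e))
    rearrange N e k = begin
      N * (H (suc k) * e)         ≈⟨ *-cong refl (trans (*-cong (H-suc k) refl) (*-assoc _ _ _)) ⟩
      N * (a * (ε (suc k) * e))   ≈⟨ *S.x∙yz≈y∙xz _ _ _ ⟩
      a * (N * (ε (suc k) * e))   ≈⟨ *-cong refl (*S.x∙yz≈y∙xz _ _ _) ⟩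
      a * (ε (suc k) * (N * e))   ∎

  F : Seq
  F k = (1# - a) * pow R (- x) k + (a * half) * (pow R (1# - x) k + pow R (- 1# - x) k)

  X : Seq
  X = pow R x

  -- Binomial theorem applied to each geometric term of F: F ⋆ x^• = H.
  F⋆X≈H : ∀ m → (F ⋆ X) m ≈ H m
  F⋆X≈H m = begin
      (F ⋆ X) m
    ≈⟨ ⋆-distribʳ m (λ k → (1# - a) * pow R (- x) k)
                    (λ k → (a * half) * (pow R (1# - x) k + pow R (- 1# - x) k)) X ⟩
      ((λ k → (1# - a) * pow R (- x) k) ⋆ X) m
        + ((λ k → (a * half) * (pow R (1# - x) k + pow R (- 1# - x) k)) ⋆ X) m
    ≈⟨ +-cong (⋆-scaleˡ m (1# - a) (pow R (- x)) X)
              (trans (⋆-scaleˡ m (a * half) _ X)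
                     (*-cong refl (⋆-distribʳ m (pow R (1# - x)) (pow R (- 1# - x)) X))) ⟩
      (1# - a) * (pow R (- x) ⋆ X) m
        + (a * half) * ((pow R (1# - x) ⋆ X) m + (pow R (- 1# - x) ⋆ X) m)
    ≈⟨ +-cong (*-cong refl (binomial m (- x) x))
              (*-cong refl (+-cong (binomial m (1# - x) x) (binomial m (- 1# - x) x))) ⟩
      (1# - a) * pow R (- x + x) m
        + (a * half) * (pow R ((1# - x) + x) m + pow R ((- 1# - x) + x) m)
    ≈⟨ +-cong (*-cong refl (pow-cong m (-‿inverseˡ x)))
              (*-cong refl (+-cong (pow-cong m (cancel 1#)) (pow-cong m (cancel (- 1#))))) ⟩
      (1# - a) * δ m + (a * half) * (pow R 1# m + pow R (- 1#) m)
    ≈⟨ +-cong refl (*-assoc _ _ _) ⟩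
      H m
    ∎
    where
    cancel : ∀ u → (u - x) + x ≈ u
    cancel u = trans (+-assoc _ _ _) (trans (+-cong refl (-‿inverseˡ x)) (+-identityʳ u))

  G : Seq
  G k = Epoly R a k x

  F⋆G≈δ : ∀ n → (F ⋆ G) n ≈ δ n
  F⋆G≈δ n = begin
      (F ⋆ (E ⋆ X)) n    ≈⟨ ⋆-congʳ n F (λ k → ⋆-comm k E X) ⟩
      (F ⋆ (X ⋆ E)) n    ≈⟨ ⋆-assoc n F X E ⟩
      ((F ⋆ X) ⋆ E) n    ≈⟨ ⋆-congˡ n E F⋆X≈H ⟩
      (H ⋆ E) n          ≈⟨ H⋆E≈δ n ⟩
      δ n                ∎

  G⋆F≈δ : ∀ n → (G ⋆ F) n ≈ δ n
  G⋆F≈δ n = trans (⋆-comm n G F) (F⋆G≈δ n)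

theorem2p7 : {c ℓ : Level} (R : CommutativeRing c ℓ) →
    let open CommutativeRing R in
    (half : Carrier) → (half + half) ≈ 1# →
    (a x : Carrier) (as bs : ℕ → Carrier) →
    ((∀ n → bs n ≈ sumTo R n (λ k → nat R (n C k) *
        (((1# - a) * pow R (- x) k
          + (a * half) * (pow R (1# - x) k + pow R (- 1# - x) k)) * as (n ∸ k))))
      → (∀ n → as n ≈ sumTo R n (λ k → nat R (n C k) * (Epoly R a k x * bs (n ∸ k)))))
    ×
    ((∀ n → as n ≈ sumTo R n (λ k → nat R (n C k) * (Epoly R a k x * bs (n ∸ k))))
      → (∀ n → bs n ≈ sumTo R n (λ k → nat R (n C k) *
        (((1# - a) * pow R (- x) k
          + (a * half) * (pow R (1# - x) k + pow R (- 1# - x) k)) * as (n ∸ k)))))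
-- Both directions are the inversion lemma for the ⋆-inverse pair (F, G).
theorem2p7 R half half+half≈1 a x as bs =
    ⋆-inversion F G as bs F⋆G≈δ
  , ⋆-inversion G F bs as G⋆F≈δ
  where
  open BinomialConvolution R using (⋆-inversion)
  open EulerNumbers R half half+half≈1 a x using (F; G; F⋆G≈δ; G⋆F≈δ)
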